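{- Let $G$ be a graph with $n$ vertices. Then for every integer $m\geq 1$, $$P_{DP}(G,m)\leq \frac{m^n (m-1)^{|E(G)|}}{m^{|E(G)|}}.$$
   Context: All graphs are finite and simple. A cover of a graph $G$ is a pair $\mathcal{H}=(L,H)$ where $H$ is a graph and $L:V(G)\to\mathcal{P}(V(H))$ satisfies: (1) the sets $L(u)$, $u\in V(G)$, partition $V(H)$; (2) each $H[L(u)]$ is complete; (3) if $E_H(L(u),L(v))$ is nonempty then $u=v$ or $uv\in E(G)$; (4) if $uv\in E(G)$ then $E_H(L(u),L(v))$ is a matching (possibly empty). Here $E_H(S,U)$ is the set of edges of $H$ with one endpoint in $S$ and one in $U$. The cover is $m$-fold if $|L(u)|=m$ for all $u$. An $\mathcal{H}$-coloring of $G$ is an independent set of $H$ of size $|V(G)|$. $P_{DP}(G,\mathcal{H})$ is the number of $\mathcal{H}$-colorings, and $P_{DP}(G,m)$ is the minimum of $P_{DP}(G,\mathcal{H})$ over all $m$-fold covers $\mathcal{H}$ of $G$. -}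

module Defs where

open import Data.Nat using (ℕ; zero; suc; _+_; _<ᵇ_; _≡ᵇ_)
open import Data.Bool using (Bool; true; false; _∧_; not; if_then_else_)
open import Data.Fin using (Fin; toℕ; _≟_)
open import Data.Fin.Subset using (Subset; ∣_∣)
open import Data.Vec using (Vec; []; _∷_; lookup)
open import Data.List using (List; []; _∷_; map; _++_; allFin)
open import Data.Nat.ListAction using (sum)
open import Data.Bool.ListAction using (and)
open import Relation.Binary.PropositionalEquality using (_≡_; _≢_)
open import Relation.Nullary.Decidable using (⌊_⌋)

countL : {A : Set} → List A → (A → Bool) → ℕ
countL [] p = 0
countL (x ∷ xs) p = (if p x then 1 else 0) + countL xs p

allSubsets : (N : ℕ) → List (Subset N)
allSubsets zero = [] ∷ []
allSubsets (suc N) = map (true ∷_) (allSubsets N) ++ map (false ∷_) (allSubsets N)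

record Graph (n : ℕ) : Set where
  field
    adj    : Fin n → Fin n → Bool
    irrefl : ∀ u → adj u u ≡ false
    sym    : ∀ u v → adj u v ≡ adj v u

numEdges : {n : ℕ} → Graph n → ℕ
numEdges {n} G =
  sum (map (λ u → countL (allFin n) (λ v → (toℕ u <ᵇ toℕ v) ∧ Graph.adj G u v)) (allFin n))

-- H is a finite simple graph on vertex set Fin N;
-- L is encoded by the map  list : Fin N → Fin n  with  x ∈ L(u)  iff  list x ≡ u,
-- so the sets L(u) automatically partition V(H)  (condition (1)).
record Cover {n : ℕ} (G : Graph n) (m : ℕ) : Set where
  field
    N       : ℕ
    hadj    : Fin N → Fin N → Bool
    hirrefl : ∀ x → hadj x x ≡ false
    hsym    : ∀ x y → hadj x y ≡ hadj y x
    list    : Fin N → Fin n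
    m-fold  : ∀ u → countL (allFin N) (λ x → ⌊ list x ≟ u ⌋) ≡ m
    clique  : ∀ x y → list x ≡ list y → x ≢ y → hadj x y ≡ true
    cross   : ∀ x y → hadj x y ≡ true → list x ≢ list y →
              Graph.adj G (list x) (list y) ≡ true
    matching : ∀ x y z → hadj x y ≡ true → hadj x z ≡ true →
               list y ≡ list z → list x ≢ list y → y ≡ z

independent : {n m : ℕ} {G : Graph n} (H : Cover G m) → Subset (Cover.N H) → Bool
independent H S =
  and (map (λ x → and (map (λ y → not (lookup S x ∧ lookup S y ∧ Cover.hadj H x y))
                           (allFin (Cover.N H))))
           (allFin (Cover.N H)))

PDP : {n m : ℕ} (G : Graph n) (H : Cover G m) → ℕ
PDP {n} G H = countL (allSubsets (Cover.N H)) (λ S → (∣ S ∣ ≡ᵇ n) ∧ independent H S)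

module Submission where

-- We use shift covers: V(H) = V(G) × Z_m, every list L(u) = {u} × Z_m is a clique, and each
-- pair of vertices carries a shift s ∈ Z_m; for an edge uv, (u , a) ~ (v , b) iff a + b ≡ s (mod m).  An independent set of size n meets every list exactly
-- once, so it is the set selected by a colouring c : V(G) → Z_m avoiding all edges of H; hence
-- P_DP(G, H) is at most the number of such proper colourings (PDP≤properCount).  For fixed
-- colours of the ends of an edge exactly one shift is forbidden, so averaging over the shifts
-- between vertex 0 and the others gives shifts with
--   #proper(G) · m^n ≤ m · (m - 1)^deg(0) · m^(n - deg(0)) · #proper(G - 0),
-- and induction on n, deleting vertex 0, produces the bound (Averaging.shifts-exist).

open import Defs
open import Data.Nat using (ℕ; zero; suc; _+_; _*_; _^_; _∸_; _≤_; _<_; z≤n; s≤s; _<ᵇ_; _≡ᵇ_; NonZero)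
open import Data.Nat.Properties hiding (_≟_)
open import Data.Nat.Properties using () renaming (_≟_ to _≟ℕ_)
open import Data.Bool using (T; Bool; true; false; _∧_; not; if_then_else_)
open import Data.Bool.Properties using (∧-conicalˡ; ∧-conicalʳ; not-involutive)
open import Data.Fin using (_≟_; Fin; zero; suc; toℕ; fromℕ<; _↑ˡ_; _↑ʳ_; combine; remQuot; quotient)
import Data.Fin.Properties as Finₚ
open Finₚ using (toℕ<n; toℕ-fromℕ<; toℕ-injective; remQuot-combine; combine-remQuot)
open import Data.List using (List; []; _∷_; map; _++_; tabulate; allFin)
import Data.Nat.ListAction as List
open import Data.Bool.ListAction using (and)
open import Data.Vec using ([]; _∷_; lookup) renaming (_++_ to _++ᵛ_)
open import Data.Vec.Properties using (lookup-++ˡ; lookup-++ʳ; []=⇒lookup)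
import Data.Vec
open import Data.Fin.Subset using (Subset; ∣_∣; ⁅_⁆; ⊥)
open import Data.Fin.Subset.Properties using (x∈⁅x⁆)
open import Data.Product using (Σ; ∃; _×_; _,_; proj₁; proj₂; uncurry; map₁)
open import Data.Sum using (_⊎_; inj₁; inj₂)
open import Data.Unit using (⊤; tt)
open import Data.Empty using (⊥-elim)
open import Relation.Binary.PropositionalEquality
open import Relation.Nullary using (Dec; does; yes; no)
open import Relation.Nullary.Decidable using (⌊_⌋; dec-true; dec-false; _⊎-dec_)
open import Function using (_∘_)
open import Data.Vec.Functional using () renaming (_∷_ to _◂_)
open import Algebra.Properties.CommutativeMonoid.Sum +-0-commutativeMonoid
  using (sum-syntax; sum-cong-≗; ∑-comm)
open import Data.Nat.Solver using (module +-*-Solver)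
open +-*-Solver using (solve; _:*_; _:=_)
open import Algebra.Properties.Semiring.Sum +-*-semiring using (*-distribˡ-sum; *-distribʳ-sum)

ind : Bool → ℕ
ind b = if b then 1 else 0

ind-mono : ∀ {x y} → (x ≡ true → y ≡ true) → ind x ≤ ind y
ind-mono {false}         x⇒y = z≤n
ind-mono {true}  {true}  x⇒y = ≤-refl
ind-mono {true}  {false} x⇒y with () ← x⇒y refl

ind≢0 : ∀ {x} → ind x ≢ 0 → x ≡ true
ind≢0 {true}  _      = refl
ind≢0 {false} ind≢0′ = ⊥-elim (ind≢0′ refl)

ind-∧ : ∀ x y → ind (x ∧ y) ≡ ind x * ind y
ind-∧ false y = refl
ind-∧ true  y = sym (+-identityʳ (ind y))

not-true : ∀ {x} → not x ≡ true → x ≡ false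
not-true {false} _ = refl

does-true : ∀ {A : Set} (a? : Dec A) → does a? ≡ true → A
does-true (yes a) _ = a

does-≟-sym : ∀ {k} (a b : Fin k) → does (a ≟ b) ≡ does (b ≟ a)
does-≟-sym a b with a ≟ b | b ≟ a
... | yes _   | yes _   = refl
... | no _    | no _    = refl
... | yes a≡b | no b≢a  = ⊥-elim (b≢a (sym a≡b))
... | no a≢b  | yes b≡a = ⊥-elim (a≢b (sym b≡a))

∑-mono : ∀ {n} {f g : Fin n → ℕ} → (∀ i → f i ≤ g i) → ∑[ i < n ] f i ≤ ∑[ i < n ] g i
∑-mono {zero}  f≤g = z≤n
∑-mono {suc n} f≤g = +-mono-≤ (f≤g zero) (∑-mono (f≤g ∘ suc))

∑-const : ∀ n x → ∑[ i < n ] x ≡ n * x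
∑-const zero    x = refl
∑-const (suc n) x = cong (x +_) (∑-const n x)

∑-ind≤ : ∀ {n} (p : Fin n → Bool) → ∑[ i < n ] ind (p i) ≤ n
∑-ind≤ {zero}  p = z≤n
∑-ind≤ {suc n} p with p zero
... | true  = s≤s (∑-ind≤ (p ∘ suc))
... | false = m≤n⇒m≤1+n (∑-ind≤ (p ∘ suc))

∑-ind-miss : ∀ {n} (p : Fin n → Bool) (i : Fin n) → p i ≡ false → suc (∑[ j < n ] ind (p j)) ≤ n
∑-ind-miss p zero    pi≡false rewrite pi≡false = s≤s (∑-ind≤ (p ∘ suc))
∑-ind-miss p (suc i) pi≡false with p zero
... | true  = s≤s (∑-ind-miss (p ∘ suc) i pi≡false)
... | false = m≤n⇒m≤1+n (∑-ind-miss (p ∘ suc) i pi≡false)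

unit+rest : ∀ {a b n} → a ≤ 1 → b ≤ n → a + b ≡ suc n → a ≡ 1 × b ≡ n
unit+rest {zero}        _        b≤n refl = ⊥-elim (1+n≰n b≤n)
unit+rest {suc zero}    _        _   a+b≡ = refl , suc-injective a+b≡
unit+rest {suc (suc a)} (s≤s ())

∑-min : ∀ k (g : Fin (suc k) → ℕ) → ∃ λ i → g i * suc k ≤ ∑[ j < suc k ] g j
∑-min zero g = zero , ≤-reflexive (trans (*-identityʳ (g zero)) (sym (+-identityʳ (g zero))))
∑-min (suc k) g with ∑-min k (g ∘ suc)
... | i , gi≤avg with g zero ≤? g (suc i)
...   | yes g0≤gi = zero , (begin
        g zero * suc (suc k)        ≡⟨ *-suc (g zero) (suc k) ⟩
        g zero + g zero * suc k     ≤⟨ +-monoʳ-≤ (g zero) (*-monoˡ-≤ (suc k) g0≤gi) ⟩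
        g zero + g (suc i) * suc k  ≤⟨ +-monoʳ-≤ (g zero) gi≤avg ⟩
        ∑[ j < suc (suc k) ] g j    ∎)
  where open ≤-Reasoning
...   | no g0≰gi = suc i , (begin
        g (suc i) * suc (suc k)        ≡⟨ *-suc (g (suc i)) (suc k) ⟩
        g (suc i) + g (suc i) * suc k  ≤⟨ +-mono-≤ (<⇒≤ (≰⇒> g0≰gi)) gi≤avg ⟩
        ∑[ j < suc (suc k) ] g j       ∎)
  where open ≤-Reasoning

∑-↑ : ∀ k l (f : Fin (k + l) → ℕ) →
      ∑[ x < k + l ] f x ≡ ∑[ i < k ] f (i ↑ˡ l) + ∑[ j < l ] f (k ↑ʳ j)
∑-↑ zero    l f = refl
∑-↑ (suc k) l f = trans (cong (f zero +_) (∑-↑ k l (f ∘ suc))) (sym (+-assoc (f zero) _ _))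

∑-combine : ∀ n m (f : Fin (n * m) → ℕ) → ∑[ x < n * m ] f x ≡ ∑[ u < n ] ∑[ a < m ] f (combine u a)
∑-combine zero    m f = refl
∑-combine (suc n) m f =
  trans (∑-↑ m (n * m) f) (cong (∑[ a < m ] f (a ↑ˡ n * m) +_) (∑-combine n m (f ∘ (m ↑ʳ_))))

∑-ind-≟ : ∀ {n} (u : Fin n) → ∑[ v < n ] ind ⌊ v ≟ u ⌋ ≡ 1
∑-ind-≟ {suc n} zero    = cong suc (trans (∑-const n 0) (*-zeroʳ n))
∑-ind-≟ {suc n} (suc u) = trans (sum-cong-≗ (λ v → cong ind (≟-suc v u))) (∑-ind-≟ u)
  where
  ≟-suc : ∀ {n} (v u : Fin n) → ⌊ suc v ≟ suc u ⌋ ≡ ⌊ v ≟ u ⌋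
  ≟-suc v u with v ≟ u
  ... | yes _ = refl
  ... | no  _ = refl

∏ : ∀ {n} → (Fin n → ℕ) → ℕ
∏ {zero}  f = 1
∏ {suc n} f = f zero * ∏ (f ∘ suc)

∏-mono : ∀ {n} {f g : Fin n → ℕ} → (∀ i → f i ≤ g i) → ∏ f ≤ ∏ g
∏-mono {zero}  f≤g = ≤-refl
∏-mono {suc n} f≤g = *-mono-≤ (f≤g zero) (∏-mono (f≤g ∘ suc))

allᶠ : ∀ {n} → (Fin n → Bool) → Bool
allᶠ {zero}  p = true
allᶠ {suc n} p = p zero ∧ allᶠ (p ∘ suc)

allᶠ-intro : ∀ {n} (p : Fin n → Bool) → (∀ i → p i ≡ true) → allᶠ p ≡ true
allᶠ-intro {zero}  p all-p = refl
allᶠ-intro {suc n} p all-p = cong₂ _∧_ (all-p zero) (allᶠ-intro (p ∘ suc) (all-p ∘ suc))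

ind-allᶠ : ∀ {n} (p : Fin n → Bool) → ind (allᶠ p) ≡ ∏ (ind ∘ p)
ind-allᶠ {zero}  p = refl
ind-allᶠ {suc n} p = trans (ind-∧ (p zero) _) (cong (ind (p zero) *_) (ind-allᶠ (p ∘ suc)))

∏-choice : ∀ {n} (x y : ℕ) (p : Fin n → Bool) →
  ∏ (λ i → if p i then x else y) * y ^ ∑[ i < n ] ind (p i) ≡ x ^ ∑[ i < n ] ind (p i) * y ^ n
∏-choice {zero} x y p = refl
∏-choice {suc n} x y p with p zero | ∏-choice x y (p ∘ suc)
... | true  | ih = begin
  x * P * (y * y ^ S)    ≡⟨ solve 4 (λ x y P Y → x :* P :* (y :* Y) := x :* y :* (P :* Y)) refl x y P (y ^ S) ⟩
  x * y * (P * y ^ S)    ≡⟨ cong (x * y *_) ih ⟩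
  x * y * (x ^ S * y ^ n) ≡⟨ solve 4 (λ x y X Y → x :* y :* (X :* Y) := x :* X :* (y :* Y)) refl x y (x ^ S) (y ^ n) ⟩
  x * x ^ S * (y * y ^ n) ∎
  where open ≡-Reasoning
        S = ∑[ i < n ] ind (p (suc i))
        P = ∏ (λ i → if p (suc i) then x else y)
... | false | ih = begin
  y * P * y ^ S          ≡⟨ *-assoc y P (y ^ S) ⟩
  y * (P * y ^ S)        ≡⟨ cong (y *_) ih ⟩
  y * (x ^ S * y ^ n)    ≡⟨ solve 3 (λ y X Y → y :* (X :* Y) := X :* (y :* Y)) refl y (x ^ S) (y ^ n) ⟩
  x ^ S * (y * y ^ n)    ∎
  where open ≡-Reasoning
        S = ∑[ i < n ] ind (p (suc i))
        P = ∏ (λ i → if p (suc i) then x else y)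

countL-tabulate : ∀ {A : Set} {n} (g : Fin n → A) (p : A → Bool) →
  countL (tabulate g) p ≡ ∑[ i < n ] ind (p (g i))
countL-tabulate {n = zero}  g p = refl
countL-tabulate {n = suc n} g p = cong (ind (p (g zero)) +_) (countL-tabulate (g ∘ suc) p)

countL-allFin : ∀ {n} (p : Fin n → Bool) → countL (allFin n) p ≡ ∑[ i < n ] ind (p i)
countL-allFin = countL-tabulate (λ i → i)

sum-map-allFin : ∀ {n} (f : Fin n → ℕ) → List.sum (map f (allFin n)) ≡ ∑[ i < n ] f i
sum-map-allFin {n} f = go (λ i → i)
  where
  go : ∀ {k} (g : Fin k → Fin n) → List.sum (map f (tabulate g)) ≡ ∑[ i < k ] f (g i)
  go {zero}  g = refl
  go {suc k} g = cong (f (g zero) +_) (go (g ∘ suc))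

and-tabulate : ∀ {A : Set} {n} (g : Fin n → A) (p : A → Bool) →
  and (map p (tabulate g)) ≡ true → ∀ i → p (g i) ≡ true
and-tabulate g p all-p zero    = ∧-conicalˡ _ _ all-p
and-tabulate g p all-p (suc i) = and-tabulate (g ∘ suc) p (∧-conicalʳ _ _ all-p) i

countL-++ : ∀ {A : Set} (xs ys : List A) (p : A → Bool) → countL (xs ++ ys) p ≡ countL xs p + countL ys p
countL-++ []       ys p = refl
countL-++ (x ∷ xs) ys p = trans (cong (ind (p x) +_) (countL-++ xs ys p)) (sym (+-assoc (ind (p x)) _ _))

countL-map : ∀ {A B : Set} (g : A → B) (xs : List A) (p : B → Bool) → countL (map g xs) p ≡ countL xs (p ∘ g)
countL-map g []       p = refl
countL-map g (x ∷ xs) p = cong (ind (p (g x)) +_) (countL-map g xs p)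

Σs : ∀ k → (Subset k → ℕ) → ℕ
Σs zero    f = f []
Σs (suc k) f = Σs k (f ∘ (true ∷_)) + Σs k (f ∘ (false ∷_))

countL-allSubsets : ∀ k (p : Subset k → Bool) → countL (allSubsets k) p ≡ Σs k (ind ∘ p)
countL-allSubsets zero    p = +-identityʳ (ind (p []))
countL-allSubsets (suc k) p = begin
  countL (map (true ∷_) (allSubsets k) ++ map (false ∷_) (allSubsets k)) p
    ≡⟨ countL-++ (map (true ∷_) (allSubsets k)) _ p ⟩
  countL (map (true ∷_) (allSubsets k)) p + countL (map (false ∷_) (allSubsets k)) p
    ≡⟨ cong₂ _+_ (countL-map (true ∷_) (allSubsets k) p) (countL-map (false ∷_) (allSubsets k) p) ⟩
  countL (allSubsets k) (p ∘ (true ∷_)) + countL (allSubsets k) (p ∘ (false ∷_))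
    ≡⟨ cong₂ _+_ (countL-allSubsets k (p ∘ (true ∷_))) (countL-allSubsets k (p ∘ (false ∷_))) ⟩
  Σs (suc k) (ind ∘ p) ∎
  where open ≡-Reasoning

Σs-zero : ∀ k (f : Subset k → ℕ) → (∀ S → f S ≡ 0) → Σs k f ≡ 0
Σs-zero zero    f f≡0 = f≡0 []
Σs-zero (suc k) f f≡0 = cong₂ _+_ (Σs-zero k _ (f≡0 ∘ (true ∷_))) (Σs-zero k _ (f≡0 ∘ (false ∷_)))

Σs-++ : ∀ k l (f : Subset (k + l) → ℕ) → Σs (k + l) f ≡ Σs k (λ S → Σs l (λ T → f (S ++ᵛ T)))
Σs-++ zero    l f = refl
Σs-++ (suc k) l f = cong₂ _+_ (Σs-++ k l (f ∘ (true ∷_))) (Σs-++ k l (f ∘ (false ∷_)))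

Σs-empty : ∀ k (f : Subset k → ℕ) → (∀ S → ∣ S ∣ ≢ 0 → f S ≡ 0) → Σs k f ≤ f ⊥
Σs-empty zero    f f≡0 = ≤-refl
Σs-empty (suc k) f f≡0 = begin
  Σs k (f ∘ (true ∷_)) + Σs k (f ∘ (false ∷_))
    ≡⟨ cong (_+ Σs k (f ∘ (false ∷_))) (Σs-zero k _ (λ S → f≡0 (true ∷ S) (λ ()))) ⟩
  Σs k (f ∘ (false ∷_))                       ≤⟨ Σs-empty k (f ∘ (false ∷_)) (f≡0 ∘ (false ∷_)) ⟩
  f ⊥ ∎
  where open ≤-Reasoning

Σs-singletons : ∀ k (f : Subset k → ℕ) → (∀ S → ∣ S ∣ ≢ 1 → f S ≡ 0) → Σs k f ≤ ∑[ a < k ] f ⁅ a ⁆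
Σs-singletons zero    f f≡0 = ≤-reflexive (f≡0 [] (λ ()))
Σs-singletons (suc k) f f≡0 = +-mono-≤
  (Σs-empty k (f ∘ (true ∷_)) (λ S ∣S∣≢0 → f≡0 (true ∷ S) (∣S∣≢0 ∘ suc-injective)))
  (Σs-singletons k (f ∘ (false ∷_)) (f≡0 ∘ (false ∷_)))

∣++∣ : ∀ {k l} (S : Subset k) (T : Subset l) → ∣ S ++ᵛ T ∣ ≡ ∣ S ∣ + ∣ T ∣
∣++∣ []          T = refl
∣++∣ (true ∷ S)  T = cong suc (∣++∣ S T)
∣++∣ (false ∷ S) T = ∣++∣ S T

∣S∣≡0 : ∀ {k} (S : Subset k) → (∀ j → lookup S j ≢ true) → ∣ S ∣ ≡ 0
∣S∣≡0 []          ∉S = refl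
∣S∣≡0 (true ∷ S)  ∉S = ⊥-elim (∉S zero refl)
∣S∣≡0 (false ∷ S) ∉S = ∣S∣≡0 S (∉S ∘ suc)

∣S∣≤1 : ∀ {k} (S : Subset k) → (∀ i j → lookup S i ≡ true → lookup S j ≡ true → i ≡ j) → ∣ S ∣ ≤ 1
∣S∣≤1 []          unique = z≤n
∣S∣≤1 (true ∷ S)  unique = s≤s (≤-reflexive (∣S∣≡0 S (λ j j∈S → Finₚ.0≢1+n (unique zero (suc j) refl j∈S))))
∣S∣≤1 (false ∷ S) unique = ∣S∣≤1 S (λ i j i∈S j∈S → Finₚ.suc-injective (unique (suc i) (suc j) i∈S j∈S))

delete₀ : ∀ {n} → Graph (suc n) → Graph n
delete₀ G = record
  { adj    = λ u v → Graph.adj G (suc u) (suc v)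
  ; irrefl = λ u → Graph.irrefl G (suc u)
  ; sym    = λ u v → Graph.sym G (suc u) (suc v)
  }

adj₀ : ∀ {n} → Graph (suc n) → Fin n → Bool
adj₀ G w = Graph.adj G zero (suc w)

deg₀ : ∀ {n} → Graph (suc n) → ℕ
deg₀ {n} G = ∑[ w < n ] ind (adj₀ G w)

numEdges-∑ : ∀ {n} (G : Graph n) →
  numEdges G ≡ ∑[ u < n ] ∑[ v < n ] ind ((toℕ u <ᵇ toℕ v) ∧ Graph.adj G u v)
numEdges-∑ {n} G =
  trans (sum-map-allFin {n} _) (sum-cong-≗ (λ u → countL-allFin (λ v → (toℕ u <ᵇ toℕ v) ∧ Graph.adj G u v)))

-- |E(G)| = deg(0) + |E(G - 0)|: the edges at 0 are exactly those counted in row 0.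
numEdges-delete₀ : ∀ {n} (G : Graph (suc n)) → numEdges G ≡ deg₀ G + numEdges (delete₀ G)
numEdges-delete₀ G = trans (numEdges-∑ G) (cong (deg₀ G +_) (sym (numEdges-∑ (delete₀ G))))

-- The cover built from cyclic shifts: H has vertex set Fin n × Fin m (encoded as Fin (n * m)),
-- each list L(u) is a clique, and for an edge uv the matching between L(u) and L(v) joins
-- (u , a) to (v , b) iff a + b ≡ s (mod m), for a shift s ∈ Fin m chosen per edge.
module ShiftCover (m : ℕ) where

  -- a + b ≡ s (mod m), for residues a, b, s < m: the sum a + b < 2m is s or s + m.
  SumsTo : Fin m → Fin m → Fin m → Set
  SumsTo s a b = toℕ a + toℕ b ≡ toℕ s ⊎ toℕ a + toℕ b ≡ toℕ s + m

  sumsTo? : ∀ s a b → Dec (SumsTo s a b)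
  sumsTo? s a b = (toℕ a + toℕ b ≟ℕ toℕ s) ⊎-dec (toℕ a + toℕ b ≟ℕ toℕ s + m)

  sumsTo : Fin m → Fin m → Fin m → Bool
  sumsTo s a b = does (sumsTo? s a b)

  sumsTo-comm : ∀ s a b → sumsTo s a b ≡ sumsTo s b a
  sumsTo-comm s a b = cong (λ x → does ((x ≟ℕ toℕ s) ⊎-dec (x ≟ℕ toℕ s + m))) (+-comm (toℕ a) (toℕ b))

  residue-unique : ∀ {x y y′ t} → y < m → y′ < m →
    x + y ≡ t ⊎ x + y ≡ t + m → x + y′ ≡ t ⊎ x + y′ ≡ t + m → y ≡ y′
  residue-unique {x} {y} {y′} {t} y<m y′<m = cases
    where
    no-wrap : ∀ {z z′} → z′ < m → x + z′ ≢ (x + z) + m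
    no-wrap {z} {z′} z′<m eq = <⇒≱ z′<m (subst (m ≤_) (sym (+-cancelˡ-≡ x z′ (z + m) (trans eq (+-assoc x z m))))
                                                     (m≤n+m m z))
    cases : x + y ≡ t ⊎ x + y ≡ t + m → x + y′ ≡ t ⊎ x + y′ ≡ t + m → y ≡ y′
    cases (inj₁ e) (inj₁ e′) = +-cancelˡ-≡ x y y′ (trans e (sym e′))
    cases (inj₂ e) (inj₂ e′) = +-cancelˡ-≡ x y y′ (trans e (sym e′))
    cases (inj₁ e) (inj₂ e′) = ⊥-elim (no-wrap y′<m (trans e′ (cong (_+ m) (sym e))))
    cases (inj₂ e) (inj₁ e′) = ⊥-elim (no-wrap y<m (trans e (cong (_+ m) (sym e′))))

  sumsTo-injective : ∀ s a b b′ → sumsTo s a b ≡ true → sumsTo s a b′ ≡ true → b ≡ b′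
  sumsTo-injective s a b b′ h h′ = toℕ-injective
    (residue-unique (toℕ<n b) (toℕ<n b′) (does-true (sumsTo? s a b) h) (does-true (sumsTo? s a b′) h′))

  sumsTo-onto : ∀ a b → ∃ λ s → sumsTo s a b ≡ true
  sumsTo-onto a b with toℕ a + toℕ b <? m
  ... | yes a+b<m = fromℕ< a+b<m , dec-true (sumsTo? _ a b) (inj₁ (sym (toℕ-fromℕ< a+b<m)))
  ... | no  a+b≮m = fromℕ< a+b-m<m ,
    dec-true (sumsTo? _ a b) (inj₂ (sym (trans (cong (_+ m) (toℕ-fromℕ< a+b-m<m)) (m∸n+n≡m m≤a+b))))
    where
    m≤a+b = ≮⇒≥ a+b≮m
    a+b-m<m : toℕ a + toℕ b ∸ m < m
    a+b-m<m = subst (toℕ a + toℕ b ∸ m <_) (m+n∸n≡m m m) (∸-monoˡ-< (+-mono-< (toℕ<n a) (toℕ<n b)) m≤a+b)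

  -- A choice of shifts, one for every pair of vertices, stored row by row:
  -- the row of vertex 0 gives the shift of each pair {0, w + 1}.
  Shift : ℕ → Set
  Shift zero    = ⊤
  Shift (suc n) = (Fin n → Fin m) × Shift n

  link : ∀ {n} → Graph n → Shift n → Fin n × Fin m → Fin n × Fin m → Bool
  link {suc n} G σ       (zero  , a) (zero  , b) = not (does (a ≟ b))
  link {suc n} G (τ , σ) (zero  , a) (suc v , b) = adj₀ G v ∧ sumsTo (τ v) a b
  link {suc n} G (τ , σ) (suc u , a) (zero  , b) = adj₀ G u ∧ sumsTo (τ u) b a
  link {suc n} G (τ , σ) (suc u , a) (suc v , b) = link (delete₀ G) σ (u , a) (v , b)

  link-irrefl : ∀ {n} (G : Graph n) σ p → link G σ p p ≡ false
  link-irrefl {suc n} G σ       (zero  , a) = cong not (dec-true (a ≟ a) refl)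
  link-irrefl {suc n} G (τ , σ) (suc u , a) = link-irrefl (delete₀ G) σ (u , a)

  link-sym : ∀ {n} (G : Graph n) σ p q → link G σ p q ≡ link G σ q p
  link-sym {suc n} G σ       (zero  , a) (zero  , b) = cong not (does-≟-sym a b)
  link-sym {suc n} G (τ , σ) (zero  , a) (suc v , b) = refl
  link-sym {suc n} G (τ , σ) (suc u , a) (zero  , b) = refl
  link-sym {suc n} G (τ , σ) (suc u , a) (suc v , b) = link-sym (delete₀ G) σ (u , a) (v , b)

  link-clique : ∀ {n} (G : Graph n) σ p q → proj₁ p ≡ proj₁ q → p ≢ q → link G σ p q ≡ true
  link-clique {suc n} G σ       (zero  , a) (zero  , b) refl p≢q = cong not (dec-false (a ≟ b) (p≢q ∘ cong (zero ,_)))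
  link-clique {suc n} G (τ , σ) (suc u , a) (suc v , b) refl p≢q =
    link-clique (delete₀ G) σ (u , a) (v , b) refl (p≢q ∘ cong (map₁ suc))

  link-cross : ∀ {n} (G : Graph n) σ p q → link G σ p q ≡ true → proj₁ p ≢ proj₁ q →
    Graph.adj G (proj₁ p) (proj₁ q) ≡ true
  link-cross {suc n} G σ       (zero  , a) (zero  , b) _ u≢v = ⊥-elim (u≢v refl)
  link-cross {suc n} G (τ , σ) (zero  , a) (suc v , b) h _   = ∧-conicalˡ _ _ h
  link-cross {suc n} G (τ , σ) (suc u , a) (zero  , b) h _   = trans (Graph.sym G (suc u) zero) (∧-conicalˡ _ _ h)
  link-cross {suc n} G (τ , σ) (suc u , a) (suc v , b) h u≢v =
    link-cross (delete₀ G) σ (u , a) (v , b) h (u≢v ∘ cong suc)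

  link-matching : ∀ {n} (G : Graph n) σ p q q′ → link G σ p q ≡ true → link G σ p q′ ≡ true →
    proj₁ q ≡ proj₁ q′ → proj₁ p ≢ proj₁ q → q ≡ q′
  link-matching {suc n} G σ       (zero  , a) (zero  , b) (zero  , b′) _ _ _ u≢v = ⊥-elim (u≢v refl)
  link-matching {suc n} G (τ , σ) (zero  , a) (suc v , b) (suc v , b′) h h′ refl _ =
    cong (suc v ,_) (sumsTo-injective (τ v) a b b′ (∧-conicalʳ _ _ h) (∧-conicalʳ _ _ h′))
  link-matching {suc n} G (τ , σ) (suc u , a) (zero  , b) (zero  , b′) h h′ refl _ =
    cong (zero ,_) (sumsTo-injective (τ u) a b b′ (trans (sumsTo-comm (τ u) a b) (∧-conicalʳ _ _ h))
                                                  (trans (sumsTo-comm (τ u) a b′) (∧-conicalʳ _ _ h′)))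
  link-matching {suc n} G (τ , σ) (suc u , a) (suc v , b) (suc v , b′) h h′ refl u≢v =
    cong (map₁ suc) (link-matching (delete₀ G) σ (u , a) (v , b) (v , b′) h h′ refl (u≢v ∘ cong suc))

  remQuot-injective : ∀ {n} {x y : Fin (n * m)} → remQuot {n} m x ≡ remQuot m y → x ≡ y
  remQuot-injective {n} {x} {y} e =
    trans (sym (combine-remQuot {n} m x)) (trans (cong (uncurry combine) e) (combine-remQuot {n} m y))

  list-size : ∀ {n} (u : Fin n) → countL (allFin (n * m)) (λ x → ⌊ quotient {n} m x ≟ u ⌋) ≡ m
  list-size {n} u = begin
    countL (allFin (n * m)) (λ x → ⌊ quotient {n} m x ≟ u ⌋)   ≡⟨ countL-allFin {n * m} _ ⟩
    ∑[ x < n * m ] ind ⌊ quotient {n} m x ≟ u ⌋                ≡⟨ ∑-combine n m _ ⟩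
    ∑[ v < n ] ∑[ a < m ] ind ⌊ quotient {n} m (combine v a) ≟ u ⌋
      ≡⟨ sum-cong-≗ (λ v → sum-cong-≗ (λ a → cong (λ w → ind ⌊ proj₁ w ≟ u ⌋) (remQuot-combine {n} {m} v a))) ⟩
    ∑[ v < n ] ∑[ a < m ] ind ⌊ v ≟ u ⌋                    ≡⟨ sum-cong-≗ (λ v → ∑-const m (ind ⌊ v ≟ u ⌋)) ⟩
    ∑[ v < n ] (m * ind ⌊ v ≟ u ⌋)                         ≡⟨ *-distribˡ-sum m (λ v → ind ⌊ v ≟ u ⌋) ⟨
    m * ∑[ v < n ] ind ⌊ v ≟ u ⌋                           ≡⟨ cong (m *_) (∑-ind-≟ u) ⟩
    m * 1                                                  ≡⟨ *-identityʳ m ⟩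
    m ∎
    where open ≡-Reasoning

  cover : ∀ {n} (G : Graph n) → Shift n → Cover G m
  cover {n} G σ = record
    { N        = n * m
    ; hadj     = λ x y → link G σ (remQuot {n} m x) (remQuot {n} m y)
    ; hirrefl  = λ x → link-irrefl G σ (remQuot {n} m x)
    ; hsym     = λ x y → link-sym G σ (remQuot {n} m x) (remQuot {n} m y)
    ; list     = quotient {n} m
    ; m-fold   = list-size
    ; clique   = λ x y same x≢y → link-clique G σ _ _ same (x≢y ∘ remQuot-injective)
    ; cross    = λ x y → link-cross G σ (remQuot {n} m x) (remQuot {n} m y)
    ; matching = λ x y z h h′ same u≢v → remQuot-injective (link-matching G σ _ _ _ h h′ same u≢v)
    }

  Colouring : ℕ → Set
  Colouring n = Fin n → Fin m

  Σc : ∀ n → (Colouring n → ℕ) → ℕ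
  Σc zero    f = f (λ ())
  Σc (suc n) f = ∑[ a < m ] Σc n (λ c → f (a ◂ c))

  Σc-cong : ∀ n {f g : Colouring n → ℕ} → (∀ c → f c ≡ g c) → Σc n f ≡ Σc n g
  Σc-cong zero    f≡g = f≡g (λ ())
  Σc-cong (suc n) f≡g = sum-cong-≗ (λ a → Σc-cong n (λ c → f≡g (a ◂ c)))

  Σc-mono : ∀ n {f g : Colouring n → ℕ} → (∀ c → f c ≤ g c) → Σc n f ≤ Σc n g
  Σc-mono zero    f≤g = f≤g (λ ())
  Σc-mono (suc n) f≤g = ∑-mono (λ a → Σc-mono n (λ c → f≤g (a ◂ c)))

  Σc-*ˡ : ∀ n x (f : Colouring n → ℕ) → Σc n (λ c → x * f c) ≡ x * Σc n f
  Σc-*ˡ zero    x f = refl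
  Σc-*ˡ (suc n) x f = trans (sum-cong-≗ (λ a → Σc-*ˡ n x (λ c → f (a ◂ c))))
                            (sym (*-distribˡ-sum x (λ a → Σc n (λ c → f (a ◂ c)))))

  Σc-*ʳ : ∀ n x (f : Colouring n → ℕ) → Σc n (λ c → f c * x) ≡ Σc n f * x
  Σc-*ʳ n x f = trans (Σc-cong n (λ c → *-comm (f c) x)) (trans (Σc-*ˡ n x f) (*-comm x (Σc n f)))

  Σc-∑-comm : ∀ n {k} (F : Colouring n → Fin k → ℕ) →
    Σc n (λ c → ∑[ i < k ] F c i) ≡ ∑[ i < k ] Σc n (λ c → F c i)
  Σc-∑-comm zero    F = refl
  Σc-∑-comm (suc n) F = trans (sum-cong-≗ (λ a → Σc-∑-comm n (λ c → F (a ◂ c))))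
                              (∑-comm (λ a i → Σc n (λ c → F (a ◂ c) i)))

  Σc-comm : ∀ n l (F : Colouring n → Colouring l → ℕ) →
    Σc n (λ c → Σc l (F c)) ≡ Σc l (λ d → Σc n (λ c → F c d))
  Σc-comm zero    l F = refl
  Σc-comm (suc n) l F = trans (sum-cong-≗ (λ a → Σc-comm n l (λ c → F (a ◂ c))))
                              (sym (Σc-∑-comm l (λ d a → Σc n (λ c → F (a ◂ c) d))))

  Σc-∏ : ∀ n (g : Fin n → Fin m → ℕ) → Σc n (λ c → ∏ (λ w → g w (c w))) ≡ ∏ (λ w → ∑[ s < m ] g w s)
  Σc-∏ zero    g = refl
  Σc-∏ (suc n) g = begin
    ∑[ a < m ] Σc n (λ c → g zero a * ∏ (λ w → g (suc w) (c w)))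
      ≡⟨ sum-cong-≗ (λ a → Σc-*ˡ n (g zero a) (λ c → ∏ (λ w → g (suc w) (c w)))) ⟩
    ∑[ a < m ] (g zero a * Σc n (λ c → ∏ (λ w → g (suc w) (c w))))
      ≡⟨ sum-cong-≗ (λ a → cong (g zero a *_) (Σc-∏ n (g ∘ suc))) ⟩
    ∑[ a < m ] (g zero a * ∏ (λ w → ∑[ s < m ] g (suc w) s))
      ≡⟨ *-distribʳ-sum (∏ (λ w → ∑[ s < m ] g (suc w) s)) (g zero) ⟨
    ∏ (λ w → ∑[ s < m ] g w s) ∎
    where open ≡-Reasoning

  -- c is proper for the shifts σ when no two of its chosen vertices (u , c u) are adjacent in H;
  -- this is checked vertex by vertex, the first vertex against all later ones.
  compatible : ∀ {n} → Graph (suc n) → (Fin n → Fin m) → Fin m → Colouring n → Bool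
  compatible G τ a c = allᶠ (λ w → not (adj₀ G w ∧ sumsTo (τ w) a (c w)))

  proper : ∀ {n} → Graph n → Shift n → Colouring n → Bool
  proper {zero}  G σ       c = true
  proper {suc n} G (τ , σ) c = compatible G τ (c zero) (c ∘ suc) ∧ proper (delete₀ G) σ (c ∘ suc)

  _∋_ : ∀ {n} → Subset (n * m) → Fin n × Fin m → Bool
  S ∋ p = lookup S (uncurry combine p)

  ∋-++-zero : ∀ {n} (S₀ : Subset m) (S : Subset (n * m)) a → _∋_ {suc n} (S₀ ++ᵛ S) (zero , a) ≡ lookup S₀ a
  ∋-++-zero {n} S₀ S a = lookup-++ˡ S₀ S a

  ∋-++-suc : ∀ {n} (S₀ : Subset m) (S : Subset (n * m)) u a → _∋_ {suc n} (S₀ ++ᵛ S) (suc u , a) ≡ S ∋ (u , a)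
  ∋-++-suc {n} S₀ S u a = lookup-++ʳ S₀ S (combine u a)

  Independent : ∀ {n} → Graph n → Shift n → Subset (n * m) → Set
  Independent G σ S = ∀ p q → (S ∋ p ∧ S ∋ q ∧ link G σ p q) ≡ false

  indep-link : ∀ {n} (G : Graph n) σ (S : Subset (n * m)) → Independent G σ S → ∀ p q →
    S ∋ p ≡ true → S ∋ q ≡ true → link G σ p q ≡ false
  indep-link G σ S indep p q p∈S q∈S =
    subst₂ (λ x y → (x ∧ y ∧ link G σ p q) ≡ false) p∈S q∈S (indep p q)

  indep-tail : ∀ {n} {G : Graph (suc n)} {τ σ} (S₀ : Subset m) (S : Subset (n * m)) →
    Independent G (τ , σ) (S₀ ++ᵛ S) → Independent (delete₀ G) σ S
  indep-tail {G = G} {σ = σ} S₀ S indep (u , a) (v , b) =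
    subst₂ (λ x y → (x ∧ y ∧ link (delete₀ G) σ (u , a) (v , b)) ≡ false)
           (∋-++-suc S₀ S u a) (∋-++-suc S₀ S v b) (indep (suc u , a) (suc v , b))

  indep-head : ∀ {n} {G : Graph (suc n)} {τ σ} (S₀ : Subset m) (S : Subset (n * m)) →
    Independent G (τ , σ) (S₀ ++ᵛ S) → ∣ S₀ ∣ ≤ 1
  indep-head {n} {G} {τ} {σ} S₀ S indep = ∣S∣≤1 S₀ λ a b a∈S₀ b∈S₀ →
    same (indep-link G (τ , σ) (S₀ ++ᵛ S) indep (zero , a) (zero , b)
                     (trans (∋-++-zero {n} S₀ S a) a∈S₀) (trans (∋-++-zero {n} S₀ S b) b∈S₀))
    where
    same : ∀ {a b : Fin m} → not (does (a ≟ b)) ≡ false → a ≡ b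
    same {a} {b} h = does-true (a ≟ b) (trans (sym (not-involutive _)) (cong not h))

  -- Hence an independent set of H meets every list at most once.
  indep-size : ∀ {n} (G : Graph n) σ (S : Subset (n * m)) → Independent G σ S → ∣ S ∣ ≤ n
  indep-size {zero}  G σ       [] indep = z≤n
  indep-size {suc n} G (τ , σ) S  indep with Data.Vec.splitAt m S
  ... | S₀ , S′ , refl = subst (_≤ suc n) (sym (∣++∣ S₀ S′))
        (+-mono-≤ (indep-head S₀ S′ indep) (indep-size (delete₀ G) σ S′ (indep-tail S₀ S′ indep)))

  Good : ∀ {n} → Graph n → Shift n → Subset (n * m) → Set
  Good {n} G σ S = ∣ S ∣ ≡ n × Independent G σ S

  good-split : ∀ {n} {G : Graph (suc n)} {τ σ} (S₀ : Subset m) (S : Subset (n * m)) →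
    Good G (τ , σ) (S₀ ++ᵛ S) → ∣ S₀ ∣ ≡ 1 × Good (delete₀ G) σ S
  good-split {n} {G} {τ} {σ} S₀ S (size , indep) = proj₁ sizes , proj₂ sizes , indep-tail S₀ S indep
    where
    sizes = unit+rest (indep-head S₀ S indep) (indep-size (delete₀ G) σ S (indep-tail S₀ S indep))
                      (trans (sym (∣++∣ S₀ S)) size)

  selection : ∀ {n} → Colouring n → Subset (n * m)
  selection {zero}  c = []
  selection {suc n} c = ⁅ c zero ⁆ ++ᵛ selection (c ∘ suc)

  ∈-selection : ∀ {n} (c : Colouring n) u → selection c ∋ (u , c u) ≡ true
  ∈-selection {suc n} c zero    =
    trans (∋-++-zero {n} ⁅ c zero ⁆ (selection (c ∘ suc)) (c zero)) ([]=⇒lookup (x∈⁅x⁆ (c zero)))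
  ∈-selection {suc n} c (suc u) =
    trans (∋-++-suc ⁅ c zero ⁆ (selection (c ∘ suc)) u (c (suc u))) (∈-selection (c ∘ suc) u)

  selection-proper : ∀ {n} (G : Graph n) σ (c : Colouring n) → Independent G σ (selection c) → proper G σ c ≡ true
  selection-proper {zero}  G σ       c indep = refl
  selection-proper {suc n} G (τ , σ) c indep = cong₂ _∧_
    (allᶠ-intro _ λ w → cong not (indep-link G (τ , σ) (selection c) indep (zero , c zero) (suc w , c (suc w))
                                             (∈-selection c zero) (∈-selection c (suc w))))
    (selection-proper (delete₀ G) σ (c ∘ suc) (indep-tail ⁅ c zero ⁆ (selection (c ∘ suc)) indep))

  -- Counting good sets: a weight supported on good sets sums to at most its sum over colourings,
  -- since every good set is selection c for some c.
  Σs-good : ∀ {n} (G : Graph n) σ (f : Subset (n * m) → ℕ) →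
    (∀ S → f S ≢ 0 → Good G σ S) → Σs (n * m) f ≤ Σc n (f ∘ selection)
  Σs-good {zero}  G σ       f good = ≤-refl
  Σs-good {suc n} G (τ , σ) f good = begin
    Σs (m + n * m) f                                      ≡⟨ Σs-++ m (n * m) f ⟩
    Σs m (λ S₀ → Σs (n * m) (λ S → f (S₀ ++ᵛ S)))        ≤⟨ Σs-singletons m _ off-singletons ⟩
    ∑[ a < m ] Σs (n * m) (λ S → f (⁅ a ⁆ ++ᵛ S))
      ≤⟨ ∑-mono (λ a → Σs-good (delete₀ G) σ (λ S → f (⁅ a ⁆ ++ᵛ S))
                       (λ S fS≢0 → proj₂ (good-split ⁅ a ⁆ S (good _ fS≢0)))) ⟩
    ∑[ a < m ] Σc n (λ c → f (⁅ a ⁆ ++ᵛ selection c))   ∎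
    where
    open ≤-Reasoning
    off-singletons : ∀ S₀ → ∣ S₀ ∣ ≢ 1 → Σs (n * m) (λ S → f (S₀ ++ᵛ S)) ≡ 0
    off-singletons S₀ ∣S₀∣≢1 = Σs-zero (n * m) _ vanish
      where
      vanish : ∀ S → f (S₀ ++ᵛ S) ≡ 0
      vanish S with f (S₀ ++ᵛ S) in fS
      ... | zero  = refl
      ... | suc _ = ⊥-elim (∣S₀∣≢1 (proj₁ (good-split S₀ S (good _ (λ f≡0 → 0≢1+n (trans (sym f≡0) fS))))))

  properCount : ∀ {n} → Graph n → Shift n → ℕ
  properCount {n} G σ = Σc n (ind ∘ proper G σ)

  independent⇒Independent : ∀ {n} (G : Graph n) σ (S : Subset (n * m)) →
    independent (cover G σ) S ≡ true → Independent G σ S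
  independent⇒Independent G σ S indep (u , a) (v , b) =
    subst₂ (λ p q → (S ∋ (u , a) ∧ S ∋ (v , b) ∧ link G σ p q) ≡ false) (remQuot-combine u a) (remQuot-combine v b)
      (not-true (and-tabulate (λ y → y) _ (and-tabulate (λ x → x) _ indep (combine u a)) (combine v b)))

  -- Every H-colouring is the set selected by a proper colouring.
  PDP≤properCount : ∀ {n} (G : Graph n) σ → PDP G (cover G σ) ≤ properCount G σ
  PDP≤properCount {n} G σ = begin
    countL (allSubsets (n * m)) good?  ≡⟨ countL-allSubsets (n * m) good? ⟩
    Σs (n * m) (ind ∘ good?)           ≤⟨ Σs-good G σ (ind ∘ good?) (λ S → decode S ∘ ind≢0) ⟩
    Σc n (ind ∘ good? ∘ selection)
      ≤⟨ Σc-mono n (λ c → ind-mono (selection-proper G σ c ∘ proj₂ ∘ decode (selection c))) ⟩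
    properCount G σ                    ∎
    where
    open ≤-Reasoning
    good? : Subset (n * m) → Bool
    good? S = (∣ S ∣ ≡ᵇ n) ∧ independent (cover G σ) S
    decode : ∀ S → good? S ≡ true → Good G σ S
    decode S h = ≡ᵇ⇒≡ ∣ S ∣ n (subst T (sym (∧-conicalˡ _ _ h)) tt)
               , independent⇒Independent G σ S (∧-conicalʳ _ _ h)

-- The arithmetic of the induction step: from the averaging bound for the new row of shifts,
-- the count of the new factors and the bound for G - 0, the bound for G follows.
bound-step : ∀ {m x n d e D D′ K} .{{_ : NonZero m}} →
  D * m ^ n ≤ m * (K * D′) → K * m ^ d ≡ x ^ d * m ^ n → D′ * m ^ e ≤ m ^ n * x ^ e →
  D * m ^ (d + e) ≤ m ^ suc n * x ^ (d + e)
bound-step {m} {x} {n} {d} {e} {D} {D′} {K} avg count ih = *-cancelʳ-≤ _ _ (m ^ n) {{m^n≢0 m n}} (begin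
  D * m ^ (d + e) * m ^ n           ≡⟨ cong (λ t → D * t * m ^ n) (^-distribˡ-+-* m d e) ⟩
  D * (m ^ d * m ^ e) * m ^ n
    ≡⟨ solve 4 (λ D P A B → D :* (A :* B) :* P := D :* P :* (A :* B)) refl D (m ^ n) (m ^ d) (m ^ e) ⟩
  D * m ^ n * (m ^ d * m ^ e)       ≤⟨ *-monoˡ-≤ (m ^ d * m ^ e) avg ⟩
  m * (K * D′) * (m ^ d * m ^ e)
    ≡⟨ solve 5 (λ m K D′ A B → m :* (K :* D′) :* (A :* B) := m :* (K :* A) :* (D′ :* B)) refl m K D′ (m ^ d) (m ^ e) ⟩
  m * (K * m ^ d) * (D′ * m ^ e)    ≡⟨ cong (λ t → m * t * (D′ * m ^ e)) count ⟩
  m * (x ^ d * m ^ n) * (D′ * m ^ e) ≤⟨ *-monoʳ-≤ (m * (x ^ d * m ^ n)) ih ⟩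
  m * (x ^ d * m ^ n) * (m ^ n * x ^ e)
    ≡⟨ solve 5 (λ m X P Y Q → m :* (X :* P) :* (Q :* Y) := m :* P :* (X :* Y) :* Q) refl m (x ^ d) (m ^ n) (x ^ e) (m ^ n) ⟩
  m * m ^ n * (x ^ d * x ^ e) * m ^ n ≡⟨ cong (λ t → m * m ^ n * t * m ^ n) (^-distribˡ-+-* x d e) ⟨
  m ^ suc n * x ^ (d + e) * m ^ n   ∎)
  where open ≤-Reasoning

module Averaging (k : ℕ) where
  open ShiftCover (suc k)

  Σc-min : ∀ n (f : Colouring n → ℕ) → ∃ λ c → f c * suc k ^ n ≤ Σc n f
  Σc-min zero    f = (λ ()) , ≤-reflexive (*-identityʳ _)
  Σc-min (suc n) f with ∑-min k (λ a → Σc n (λ c → f (a ◂ c)))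
  ... | a , a-min with Σc-min n (λ c → f (a ◂ c))
  ... | c , c-min = a ◂ c , (begin
    f (a ◂ c) * (suc k * suc k ^ n)
      ≡⟨ solve 3 (λ F m P → F :* (m :* P) := F :* P :* m) refl (f (a ◂ c)) (suc k) (suc k ^ n) ⟩
    f (a ◂ c) * suc k ^ n * suc k    ≤⟨ *-monoˡ-≤ (suc k) c-min ⟩
    Σc n (λ c → f (a ◂ c)) * suc k   ≤⟨ a-min ⟩
    Σc (suc n) f                     ∎)
    where open ≤-Reasoning

  -- Given the colours at both ends, the number of shifts for the pair {0, w + 1} that keep them
  -- non-adjacent in H: all m of them for a non-edge, all but the one matching the colours for an edge.
  allowed : ∀ {n} → Graph (suc n) → Fin n → ℕ
  allowed G w = if adj₀ G w then k else suc k

  compatible-count : ∀ {n} (G : Graph (suc n)) a (c : Colouring n) →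
    Σc n (λ τ → ind (compatible G τ a c)) ≤ ∏ (allowed G)
  compatible-count {n} G a c = begin
    Σc n (λ τ → ind (compatible G τ a c))
      ≡⟨ Σc-cong n (λ τ → ind-allᶠ (λ w → not (adj₀ G w ∧ sumsTo (τ w) a (c w)))) ⟩
    Σc n (λ τ → ∏ (λ w → ind (not (adj₀ G w ∧ sumsTo (τ w) a (c w)))))
      ≡⟨ Σc-∏ n (λ w s → ind (not (adj₀ G w ∧ sumsTo s a (c w)))) ⟩
    ∏ (λ w → ∑[ s < suc k ] ind (not (adj₀ G w ∧ sumsTo s a (c w))))
      ≤⟨ ∏-mono factor ⟩
    ∏ (allowed G) ∎
    where
    open ≤-Reasoning
    factor : ∀ w → ∑[ s < suc k ] ind (not (adj₀ G w ∧ sumsTo s a (c w))) ≤ allowed G w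
    factor w with adj₀ G w | sumsTo-onto a (c w)
    ... | false | _        = ∑-ind≤ (λ _ → true)
    ... | true  | s , a~cw = ≤-pred (∑-ind-miss (λ s → not (sumsTo s a (c w))) s (cong not a~cw))

  row-average : ∀ {n} (G : Graph (suc n)) (σ : Shift n) →
    Σc n (λ τ → properCount G (τ , σ)) ≤ suc k * (∏ (allowed G) * properCount (delete₀ G) σ)
  row-average {n} G σ = begin
    Σc n (λ τ → ∑[ a < suc k ] Σc n (λ c → X τ a c))
      ≡⟨ Σc-∑-comm n (λ τ a → Σc n (λ c → X τ a c)) ⟩
    ∑[ a < suc k ] Σc n (λ τ → Σc n (λ c → X τ a c))
      ≡⟨ sum-cong-≗ {suc k} (λ a → Σc-comm n n (λ τ c → X τ a c)) ⟩
    ∑[ a < suc k ] Σc n (λ c → Σc n (λ τ → X τ a c))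
      ≡⟨ sum-cong-≗ {suc k} (λ a → Σc-cong n (λ c → split a c)) ⟩
    ∑[ a < suc k ] Σc n (λ c → Σc n (λ τ → ind (compatible G τ a c)) * ind (proper (delete₀ G) σ c))
      ≤⟨ ∑-mono {suc k} (λ a → Σc-mono n (λ c →
           *-monoˡ-≤ (ind (proper (delete₀ G) σ c)) (compatible-count G a c))) ⟩
    ∑[ a < suc k ] Σc n (λ c → K * ind (proper (delete₀ G) σ c))
      ≡⟨ sum-cong-≗ {suc k} (λ a → Σc-*ˡ n K (ind ∘ proper (delete₀ G) σ)) ⟩
    ∑[ a < suc k ] (K * properCount (delete₀ G) σ)
      ≡⟨ ∑-const (suc k) (K * properCount (delete₀ G) σ) ⟩
    suc k * (K * properCount (delete₀ G) σ) ∎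
    where
    open ≤-Reasoning
    K = ∏ (allowed G)
    X : Colouring n → Fin (suc k) → Colouring n → ℕ
    X τ a c = ind (compatible G τ a c ∧ proper (delete₀ G) σ c)
    split : ∀ a c → Σc n (λ τ → X τ a c) ≡ Σc n (λ τ → ind (compatible G τ a c)) * ind (proper (delete₀ G) σ c)
    split a c = trans (Σc-cong n (λ τ → ind-∧ (compatible G τ a c) (proper (delete₀ G) σ c)))
                      (Σc-*ʳ n (ind (proper (delete₀ G) σ c)) (λ τ → ind (compatible G τ a c)))

  shifts-exist : ∀ n (G : Graph n) → ∃ λ σ → properCount G σ * suc k ^ numEdges G ≤ suc k ^ n * k ^ numEdges G
  shifts-exist zero    G = tt , ≤-refl
  shifts-exist (suc n) G with shifts-exist n (delete₀ G)
  ... | σ , ih with Σc-min n (λ τ → properCount G (τ , σ))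
  ... | τ , τ-min = (τ , σ) , subst (λ e → properCount G (τ , σ) * suc k ^ e ≤ suc k ^ suc n * k ^ e)
                                     (sym (numEdges-delete₀ G)) bound
    where
    d = deg₀ G
    e = numEdges (delete₀ G)
    bound : properCount G (τ , σ) * suc k ^ (d + e) ≤ suc k ^ suc n * k ^ (d + e)
    bound = bound-step {x = k} {n = n} {d = d} {e = e}
                       {D = properCount G (τ , σ)} {D′ = properCount (delete₀ G) σ} {K = ∏ (allowed G)}
                       (≤-trans τ-min (row-average G σ)) (∏-choice k (suc k) (adj₀ G)) ih

proposition2p1 : (n : ℕ) (G : Graph n) (m : ℕ) → 1 ≤ m →
    Σ (Cover G m) (λ H → PDP G H * m ^ numEdges G ≤ m ^ n * (m ∸ 1) ^ numEdges G)
proposition2p1 n G zero    ()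
proposition2p1 n G (suc k) _ with Averaging.shifts-exist k n G
... | σ , few-colourings = cover G σ , ≤-trans (*-monoˡ-≤ (suc k ^ numEdges G) (PDP≤properCount G σ)) few-colourings
  where open ShiftCover (suc k)
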